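{- Let $d$ be a degree sequence. Then: (i) if two entries in a single line (row or column) of $M(d)$ are both nonzero, then they and all entries between them in that line are equal; (ii) $M(d)$ contains no $2\times 2$ submatrix (formed by rows $i_1<i_2$ and columns $j_1<j_2$) of the form $\begin{bmatrix}a&b\\0&c\end{bmatrix}$ with $a$ and $c$ nonzero.
   Context: A degree sequence $d=(d_1,\dots,d_n)$ is written in nonincreasing order. The corrected Ferrers diagram $F(d)$ is the $n\times n$ matrix with stars on the main diagonal in which, for each $i$, the first $d_i$ non-diagonal entries of row $i$ equal $1$ and all other non-diagonal entries equal $0$; stars are treated as zero entries. The difference matrix is $M(d)=F(d)^T-F(d)$, with star (zero) entries on the diagonal. -}

module Defs where

open import Data.Nat using (ℕ; _<?_; _∸_; _≤_)
open import Data.Fin using (Fin; toℕ; _≟_)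
open import Data.Fin.Base using (_<_)
open import Data.Bool using (Bool; true; false; if_then_else_)
open import Data.List using (map)
open import Data.Nat.ListAction using (sum)
open import Data.List.Base using (allFin)
open import Data.Integer using (ℤ; +_; _-_)
open import Relation.Nullary.Decidable using (⌊_⌋)
open import Relation.Binary.PropositionalEquality using (_≡_)

-- A sequence d = (d_1,…,d_n) is represented as a function Fin n → ℕ (0-indexed).

Nonincreasing : {n : ℕ} → (Fin n → ℕ) → Set
Nonincreasing {n} d = ∀ (i j : Fin n) → toℕ i ≤ toℕ j → d j ≤ d i

record SimpleGraph (n : ℕ) : Set where
  field
    adj       : Fin n → Fin n → Bool
    symmetric : ∀ i j → adj i j ≡ adj j i
    irreflex  : ∀ i → adj i i ≡ false

degree : {n : ℕ} → SimpleGraph n → Fin n → ℕ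
degree {n} G i = sum (map (λ j → if SimpleGraph.adj G i j then 1 else 0) (allFin n))

record DegreeSequence {n : ℕ} (d : Fin n → ℕ) : Set where
  field
    nonincreasing : Nonincreasing d
    graph         : SimpleGraph n
    realizes      : ∀ i → degree graph i ≡ d i

-- Index of column j among the non-diagonal positions of row i (0-based).
offDiagPos : {n : ℕ} → Fin n → Fin n → ℕ
offDiagPos i j = if ⌊ toℕ j <? toℕ i ⌋ then toℕ j else toℕ j ∸ 1

-- Corrected Ferrers diagram F(d): diagonal (star) entries are 0; in row i the first d_i
-- non-diagonal entries are 1, the rest 0.
ferrers : {n : ℕ} → (Fin n → ℕ) → Fin n → Fin n → ℤ
ferrers d i j =
  if ⌊ i ≟ j ⌋ then + 0
  else (if ⌊ offDiagPos i j <? d i ⌋ then + 1 else + 0)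

diffMatrix : {n : ℕ} → (Fin n → ℕ) → Fin n → Fin n → ℤ
diffMatrix d i j = ferrers d j i - ferrers d i j

-- Off the diagonal, the 0/1 pattern of F(d) is a staircase: every row is closed to the left,
-- and, because d is nonincreasing, every column is closed upwards; nothing else is used.
-- M(d) is nonzero at (i, j) exactly when the mirrored entries (i, j) and (j, i) of F(d) differ,
-- and its sign says which of them is 1. Starting from such a disagreement, one or two closure
-- steps either carry it, with its sign, to any position further inside the line, or produce
-- a mirrored pair of ones where a disagreement was assumed. The latter rules out the corner
-- pattern and also two disagreements at (a, k) and (k, b) with a < k < b, which is what keeps
-- the diagonal from interrupting a line.
module Submission where

open import Defs
open import Data.Nat using (ℕ)
open import Data.Fin using (Fin; _<_; _≤_)
open import Data.Integer using (ℤ; +_)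
open import Data.Product using (_×_)
open import Relation.Nullary using (¬_)
open import Relation.Binary.PropositionalEquality using (_≡_)

open import Data.Bool using (Bool; true; false; T)
open import Data.Empty using (⊥; ⊥-elim)
open import Data.Fin using (toℕ; _≟_)
open import Data.Fin.Properties using (≤-trans; ≤∧≢⇒<; <⇒≢)
open import Data.Integer using (0ℤ; 1ℤ; -1ℤ; _-_)
open import Data.Nat using (_<?_) renaming (_≤_ to _≤ℕ_; _<_ to _<ℕ_)
import Data.Nat.Properties as ℕ
open import Data.Product using (_,_; proj₂)
open import Data.Sum using (_⊎_; inj₁; inj₂; swap)
open import Function using (_∘_)
open import Relation.Nullary using (yes; no)
open import Relation.Nullary.Decidable using (⌊_⌋; ¬?; _×-dec_; toWitness; fromWitness)
open import Relation.Binary.PropositionalEquality using (_≢_; refl; sym; trans; cong₂; subst; ≢-sym)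

private
  variable
    n : ℕ

Matrix : Set → ℕ → Set
Matrix A n = Fin n → Fin n → A

_ᵀ : {A : Set} → Matrix A n → Matrix A n
(E ᵀ) i j = E j i

record FerrersShaped (E : Matrix Bool n) : Set where
  field
    left-closed : ∀ {i j k} → i ≢ j → j ≤ k → T (E i k) → T (E i j)
    up-closed   : ∀ {i j k} → i ≢ j → i ≤ k → T (E k j) → T (E i j)

ᵀ-ferrersShaped : {E : Matrix Bool n} → FerrersShaped E → FerrersShaped (E ᵀ)
ᵀ-ferrersShaped shaped = record
  { left-closed = λ i≢j → up-closed (≢-sym i≢j)
  ; up-closed   = λ i≢j → left-closed (≢-sym i≢j)
  }
  where open FerrersShaped shaped

Exceeds : Matrix Bool n → Fin n → Fin n → Set
Exceeds E i j = T (E i j) × ¬ T (E j i)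

-- Differ (E ᵀ) i j and Exceeds (E ᵀ) i j unfold to Differ E j i and Exceeds E j i, so results
-- proved for one orientation transfer to the other by instantiating them at E ᵀ.
Differ : Matrix Bool n → Fin n → Fin n → Set
Differ E i j = Exceeds E i j ⊎ Exceeds E j i

module DifferProperties (E : Matrix Bool n) where

  differ-¬both : ∀ {i j} → Differ E i j → T (E i j) → T (E j i) → ⊥
  differ-¬both (inj₁ (_ , ¬tji)) _   tji = ¬tji tji
  differ-¬both (inj₂ (_ , ¬tij)) tij _   = ¬tij tij

  differ-¬T⇒T : ∀ {i j} → Differ E i j → ¬ T (E j i) → T (E i j)
  differ-¬T⇒T (inj₁ (tij , _)) _    = tij
  differ-¬T⇒T (inj₂ (tji , _)) ¬tji = ⊥-elim (¬tji tji)

  differ⇒≢ : ∀ {i j} → Differ E i j → i ≢ j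
  differ⇒≢ (inj₁ (t , ¬t)) refl = ¬t t
  differ⇒≢ (inj₂ (t , ¬t)) refl = ¬t t

module Oriented {E : Matrix Bool n} (shaped : FerrersShaped E) where
  open FerrersShaped shaped
  open DifferProperties E

  exceeds-no-sandwich : ∀ {a k b} → a < k → k < b → Differ E a k → Exceeds E k b → ⊥
  exceeds-no-sandwich {a} {k} {b} a<k k<b differ (tkb , _) = differ-¬both differ tak tka
    where
    a≢k : a ≢ k
    a≢k = differ⇒≢ differ
    tka : T (E k a)
    tka = left-closed (≢-sym a≢k) (≤-trans (ℕ.<⇒≤ a<k) (ℕ.<⇒≤ k<b)) tkb
    tab : T (E a b)
    tab = up-closed (<⇒≢ (ℕ.<-trans a<k k<b)) (ℕ.<⇒≤ a<k) tkb
    tak : T (E a k)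
    tak = left-closed a≢k (ℕ.<⇒≤ k<b) tab

  exceeds-no-corner : ∀ {i₁ i₂ j₁ j₂} → i₁ ≤ i₂ → j₁ ≤ j₂ → i₂ ≢ j₁ →
    Differ E i₁ j₁ → E i₂ j₁ ≡ E j₁ i₂ → Exceeds E i₂ j₂ → ⊥
  exceeds-no-corner {i₁} {i₂} {j₁} i₁≤i₂ j₁≤j₂ i₂≢j₁ differ mirror (ti₂j₂ , _) =
    differ-¬both differ ti₁j₁ tj₁i₁
    where
    i₁≢j₁ : i₁ ≢ j₁
    i₁≢j₁ = differ⇒≢ differ
    ti₂j₁ : T (E i₂ j₁)
    ti₂j₁ = left-closed i₂≢j₁ j₁≤j₂ ti₂j₂
    tj₁i₁ : T (E j₁ i₁)
    tj₁i₁ = left-closed (≢-sym i₁≢j₁) i₁≤i₂ (subst T mirror ti₂j₁)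
    ti₁j₁ : T (E i₁ j₁)
    ti₁j₁ = up-closed i₁≢j₁ i₁≤i₂ ti₂j₁

module _ {E : Matrix Bool n} (shaped : FerrersShaped E) where
  open FerrersShaped shaped
  open DifferProperties E
  private
    module O = Oriented shaped
    module Oᵀ = Oriented (ᵀ-ferrersShaped shaped)

  no-sandwich : ∀ {a k b} → a < k → k < b → Differ E a k → Differ E k b → ⊥
  no-sandwich a<k k<b differ (inj₁ exceeds) = O.exceeds-no-sandwich a<k k<b differ exceeds
  no-sandwich a<k k<b differ (inj₂ exceeds) = Oᵀ.exceeds-no-sandwich a<k k<b (swap differ) exceeds

  no-corner : ∀ {i₁ i₂ j₁ j₂} → i₁ < i₂ → j₁ < j₂ →
    Differ E i₁ j₁ → E i₂ j₁ ≡ E j₁ i₂ → Differ E i₂ j₂ → ⊥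
  no-corner {i₂ = i₂} {j₁} i₁<i₂ j₁<j₂ differ₁ mirror differ₂ with i₂ ≟ j₁
  ... | yes refl = no-sandwich i₁<i₂ j₁<j₂ differ₁ differ₂
  ... | no i₂≢j₁ with differ₂
  ...   | inj₁ exceeds = O.exceeds-no-corner (ℕ.<⇒≤ i₁<i₂) (ℕ.<⇒≤ j₁<j₂) i₂≢j₁ differ₁ mirror exceeds
  ...   | inj₂ exceeds = Oᵀ.exceeds-no-corner (ℕ.<⇒≤ i₁<i₂) (ℕ.<⇒≤ j₁<j₂) i₂≢j₁
                           (swap differ₁) (sym mirror) exceeds

  exceeds-between : ∀ {i a k b} → a ≤ k → k ≤ b → Exceeds E a i → Differ E b i → Exceeds E k i
  exceeds-between {i} {a} {k} {b} a≤k k≤b exceeds@(_ , ¬tia) differ = up-closed k≢i k≤b tbi , ¬tik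
    where
    a≢i : a ≢ i
    a≢i = differ⇒≢ (inj₁ exceeds)
    k≢i : k ≢ i
    k≢i refl = no-sandwich (≤∧≢⇒< a≤k a≢i) (≤∧≢⇒< k≤b (≢-sym (differ⇒≢ differ)))
                           (inj₁ exceeds) (swap differ)
    tbi : T (E b i)
    tbi = differ-¬T⇒T differ (λ tib → ¬tia (left-closed (≢-sym a≢i) (≤-trans a≤k k≤b) tib))
    ¬tik : ¬ T (E i k)
    ¬tik tik = ¬tia (left-closed (≢-sym a≢i) a≤k tik)

ind : Bool → ℤ
ind true  = 1ℤ
ind false = 0ℤ

ind-exceeds⁺ : ∀ {x y} → T x → ¬ T y → ind x - ind y ≡ 1ℤ
ind-exceeds⁺ {true} {true}  _ ¬ty = ⊥-elim (¬ty _)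
ind-exceeds⁺ {true} {false} _ _   = refl

ind-exceeds⁻ : ∀ {x y} → ¬ T x → T y → ind x - ind y ≡ -1ℤ
ind-exceeds⁻ {true}  {true} ¬tx _ = ⊥-elim (¬tx _)
ind-exceeds⁻ {false} {true} _   _ = refl

ind-differ : ∀ x y → ind x - ind y ≢ 0ℤ → (T y × ¬ T x) ⊎ (T x × ¬ T y)
ind-differ true  true  ≢0 = ⊥-elim (≢0 refl)
ind-differ true  false _  = inj₂ (_ , λ ())
ind-differ false true  _  = inj₁ (_ , λ ())
ind-differ false false ≢0 = ⊥-elim (≢0 refl)

ind-cancel : ∀ x y → ind x - ind y ≡ 0ℤ → y ≡ x
ind-cancel true  true  _  = refl
ind-cancel false false _  = refl

skew : Matrix ℤ n → Matrix ℤ n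
skew F i j = F j i - F i j

module Skew {E : Matrix Bool n} (shaped : FerrersShaped E)
            {F : Matrix ℤ n} (F≡ind : ∀ i j → F i j ≡ ind (E i j)) where

  skew≡ind : ∀ i j → skew F i j ≡ ind (E j i) - ind (E i j)
  skew≡ind i j = cong₂ _-_ (F≡ind j i) (F≡ind i j)

  skew-exceeds⁺ : ∀ {i j} → Exceeds E j i → skew F i j ≡ 1ℤ
  skew-exceeds⁺ {i} {j} (tji , ¬tij) = trans (skew≡ind i j) (ind-exceeds⁺ tji ¬tij)

  skew-exceeds⁻ : ∀ {i j} → Exceeds E i j → skew F i j ≡ -1ℤ
  skew-exceeds⁻ {i} {j} (tij , ¬tji) = trans (skew≡ind i j) (ind-exceeds⁻ ¬tji tij)

  skew≢0⇒differ : ∀ {i j} → skew F i j ≢ 0ℤ → Differ E i j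
  skew≢0⇒differ {i} {j} ≢0 = ind-differ (E j i) (E i j) (≢0 ∘ trans (skew≡ind i j))

  skew≡0⇒mirror : ∀ {i j} → skew F i j ≡ 0ℤ → E i j ≡ E j i
  skew≡0⇒mirror {i} {j} ≡0 = ind-cancel (E j i) (E i j) (trans (sym (skew≡ind i j)) ≡0)

  row-constant : ∀ {i j₁ j₂ k} → skew F i j₁ ≢ 0ℤ → skew F i j₂ ≢ 0ℤ →
    j₁ ≤ k → k ≤ j₂ → skew F i k ≡ skew F i j₁
  row-constant {i} {k = k} nz₁ nz₂ j₁≤k k≤j₂ with skew≢0⇒differ nz₁
  ... | inj₁ exceeds = trans (skew-exceeds⁻ exceeds-k) (sym (skew-exceeds⁻ exceeds))
    where
    exceeds-k : Exceeds E i k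
    exceeds-k = exceeds-between (ᵀ-ferrersShaped shaped) j₁≤k k≤j₂ exceeds (skew≢0⇒differ nz₂)
  ... | inj₂ exceeds = trans (skew-exceeds⁺ exceeds-k) (sym (skew-exceeds⁺ exceeds))
    where
    exceeds-k : Exceeds E k i
    exceeds-k = exceeds-between shaped j₁≤k k≤j₂ exceeds (swap (skew≢0⇒differ nz₂))

  no-skew-corner : ∀ {i₁ i₂ j₁ j₂} → i₁ < i₂ → j₁ < j₂ →
    skew F i₁ j₁ ≢ 0ℤ → skew F i₂ j₁ ≡ 0ℤ → skew F i₂ j₂ ≢ 0ℤ → ⊥
  no-skew-corner i₁<i₂ j₁<j₂ nz₁ z nz₂ =
    no-corner shaped i₁<i₂ j₁<j₂ (skew≢0⇒differ nz₁) (skew≡0⇒mirror z) (skew≢0⇒differ nz₂)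

column-constant : {E : Matrix Bool n} → FerrersShaped E →
  {F : Matrix ℤ n} → (∀ i j → F i j ≡ ind (E i j)) →
  ∀ {j i₁ i₂ k} → skew F i₁ j ≢ 0ℤ → skew F i₂ j ≢ 0ℤ →
  i₁ ≤ k → k ≤ i₂ → skew F k j ≡ skew F i₁ j
column-constant shaped F≡ind = Skew.row-constant (ᵀ-ferrersShaped shaped) (λ i j → F≡ind j i)

offDiagPos-monoʳ : ∀ (i : Fin n) {j k} → j ≤ k → offDiagPos i j ≤ℕ offDiagPos i k
offDiagPos-monoʳ i {j} {k} j≤k with toℕ j <? toℕ i | toℕ k <? toℕ i
... | yes _   | yes _   = j≤k
... | yes j<i | no k≮i  = ℕ.<⇒≤pred (ℕ.<-≤-trans j<i (ℕ.≮⇒≥ k≮i))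
... | no j≮i  | yes k<i = ⊥-elim (j≮i (ℕ.≤-<-trans j≤k k<i))
... | no _    | no _    = ℕ.∸-monoˡ-≤ 1 j≤k

offDiagPos-monoˡ : ∀ {i k} (j : Fin n) → i ≤ k → offDiagPos i j ≤ℕ offDiagPos k j
offDiagPos-monoˡ {i = i} {k} j i≤k with toℕ j <? toℕ i | toℕ j <? toℕ k
... | yes _   | yes _  = ℕ.≤-refl
... | yes j<i | no j≮k = ⊥-elim (j≮k (ℕ.<-≤-trans j<i i≤k))
... | no _    | yes _  = ℕ.pred[n]≤n
... | no _    | no _   = ℕ.≤-refl

entry : (Fin n → ℕ) → Matrix Bool n
entry d i j = ⌊ ¬? (i ≟ j) ×-dec offDiagPos i j <? d i ⌋

ferrers≡ind : (d : Fin n → ℕ) → ∀ i j → ferrers d i j ≡ ind (entry d i j)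
ferrers≡ind d i j with i ≟ j | offDiagPos i j <? d i
... | yes _ | _     = refl
... | no _  | yes _ = refl
... | no _  | no _  = refl

module _ {d : Fin n → ℕ} where

  entry-intro : ∀ {i j} → i ≢ j → offDiagPos i j <ℕ d i → T (entry d i j)
  entry-intro {i} {j} i≢j bound = fromWitness {a? = ¬? (i ≟ j) ×-dec offDiagPos i j <? d i} (i≢j , bound)

  entry-bound : ∀ {i j} → T (entry d i j) → offDiagPos i j <ℕ d i
  entry-bound {i} {j} t = proj₂ (toWitness {a? = ¬? (i ≟ j) ×-dec offDiagPos i j <? d i} t)

  entry-ferrersShaped : Nonincreasing d → FerrersShaped (entry d)
  entry-ferrersShaped nonincreasing = record
    { left-closed = λ {i} i≢j j≤k t →
        entry-intro i≢j (ℕ.≤-<-trans (offDiagPos-monoʳ i j≤k) (entry-bound t))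
    ; up-closed = λ {i} {j} {k} i≢j i≤k t →
        entry-intro i≢j (ℕ.<-≤-trans (ℕ.≤-<-trans (offDiagPos-monoˡ j i≤k) (entry-bound t))
                                     (nonincreasing i k i≤k))
    }

lemma3p7 : ∀ (n : ℕ) (d : Fin n → ℕ) → DegreeSequence d →
    (∀ (i j₁ j₂ : Fin n) → j₁ < j₂ →
       ¬ (diffMatrix d i j₁ ≡ + 0) → ¬ (diffMatrix d i j₂ ≡ + 0) →
       ∀ (k : Fin n) → j₁ ≤ k → k ≤ j₂ → diffMatrix d i k ≡ diffMatrix d i j₁)
    ×
    (∀ (j i₁ i₂ : Fin n) → i₁ < i₂ →
       ¬ (diffMatrix d i₁ j ≡ + 0) → ¬ (diffMatrix d i₂ j ≡ + 0) →
       ∀ (k : Fin n) → i₁ ≤ k → k ≤ i₂ → diffMatrix d k j ≡ diffMatrix d i₁ j)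
    ×
    (∀ (i₁ i₂ j₁ j₂ : Fin n) → i₁ < i₂ → j₁ < j₂ →
       ¬ (¬ (diffMatrix d i₁ j₁ ≡ + 0) × diffMatrix d i₂ j₁ ≡ + 0 × ¬ (diffMatrix d i₂ j₂ ≡ + 0)))
lemma3p7 n d ds =
    (λ i j₁ j₂ _ nz₁ nz₂ k → row-constant nz₁ nz₂)
  , (λ j i₁ i₂ _ nz₁ nz₂ k → column-constant shaped (ferrers≡ind d) {j} nz₁ nz₂)
  , (λ i₁ i₂ j₁ j₂ i₁<i₂ j₁<j₂ (nz₁ , z , nz₂) → no-skew-corner i₁<i₂ j₁<j₂ nz₁ z nz₂)
  where
  shaped : FerrersShaped (entry d)
  shaped = entry-ferrersShaped (DegreeSequence.nonincreasing ds)
  open Skew shaped (ferrers≡ind d)
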